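{- Let $T$ be a subresiduated Nelson algebra. Then the set of h-implicative filters of $T$ coincides with the set of open implicative filters of $T$.
   Context: A Kleene algebra is a bounded distributive lattice $\langle T,\wedge,\vee,0,1\rangle$ with a unary operation $\sim$ such that $\sim\sim x=x$, $\sim(x\wedge y)=\sim x\vee\sim y$ and $(x\wedge\sim x)\wedge(y\vee\sim y)=x\wedge\sim x$. A subresiduated Nelson algebra is an algebra $\langle T,\wedge,\vee,\rightarrow,\sim,0,1\rangle$ of type $(2,2,2,1,0,0)$ such that $\langle T,\wedge,\vee,\sim,0,1\rangle$ is a Kleene algebra and for all $x,y,z\in T$: (1) $(x\vee y)\rightarrow z=(x\rightarrow z)\wedge(y\rightarrow z)$; (2) $z\rightarrow(x\wedge y)=(z\rightarrow x)\wedge(z\rightarrow y)$; (3) $((x\rightarrow y)\wedge(y\rightarrow z))\rightarrow(x\rightarrow z)=1$; (4) $x\rightarrow x=1$; (5) $x\wedge(x\rightarrow y)\le x\wedge(\sim x\vee y)$; (6) $x\rightarrow y\le z\rightarrow(x\rightarrow y)$; (7) $\sim(x\rightarrow y)\rightarrow(x\wedge\sim y)=1$; (8) $(x\wedge\sim y)\rightarrow\sim(x\rightarrow y)=1$. A subset $F\subseteq T$ is an implicative filter if $1\in F$ and for all $x,y\in T$, if $x\in F$ and $x\rightarrow y\in F$ then $y\in F$. An implicative filter $F$ is open if $1\rightarrow x\in F$ whenever $x\in F$. An implicative filter $F$ is an h-implicative filter if for all $x,y\in T$ and $f\in F$: (F1) $(x\rightarrow y)\rightarrow((x\wedge f)\rightarrow(y\wedge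 f))\in F$; (F2) $((x\wedge f)\rightarrow(y\wedge f))\rightarrow(x\rightarrow y)\in F$; (F3) $\sim(x\rightarrow y)\rightarrow\sim((x\wedge f)\rightarrow(y\wedge f))\in F$; (F4) $\sim((x\wedge f)\rightarrow(y\wedge f))\rightarrow\sim(x\rightarrow y)\in F$. -}

module Defs where

open import Level using (Level; suc; _⊔_)
open import Relation.Binary.PropositionalEquality using (_≡_)
open import Algebra.Core using (Op₁; Op₂)
open import Algebra.Lattice.Structures using (IsDistributiveLattice)

record SubresiduatedNelsonAlgebra (a : Level) : Set (suc a) where
  infixr 7 _∧_
  infixr 6 _∨_
  infixr 5 _⇒_
  infix 4 _≤_
  field
    Carrier : Set a
    _∧_ _∨_ _⇒_ : Op₂ Carrier
    ∼ : Op₁ Carrier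
    𝟘 𝟙 : Carrier
  _≤_ : Carrier → Carrier → Set a
  x ≤ y = x ∧ y ≡ x
  field
    isDistributiveLattice : IsDistributiveLattice _≡_ _∨_ _∧_
    𝟘-least : ∀ x → 𝟘 ≤ x
    𝟙-greatest : ∀ x → x ≤ 𝟙
    ∼-invol : ∀ x → ∼ (∼ x) ≡ x
    ∼-deMorgan : ∀ x y → ∼ (x ∧ y) ≡ ∼ x ∨ ∼ y
    kleene : ∀ x y → (x ∧ ∼ x) ∧ (y ∨ ∼ y) ≡ x ∧ ∼ x
    ax1 : ∀ x y z → (x ∨ y) ⇒ z ≡ (x ⇒ z) ∧ (y ⇒ z)
    ax2 : ∀ x y z → z ⇒ (x ∧ y) ≡ (z ⇒ x) ∧ (z ⇒ y)
    ax3 : ∀ x y z → ((x ⇒ y) ∧ (y ⇒ z)) ⇒ (x ⇒ z) ≡ 𝟙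
    ax4 : ∀ x → x ⇒ x ≡ 𝟙
    ax5 : ∀ x y → x ∧ (x ⇒ y) ≤ x ∧ (∼ x ∨ y)
    ax6 : ∀ x y z → x ⇒ y ≤ z ⇒ (x ⇒ y)
    ax7 : ∀ x y → ∼ (x ⇒ y) ⇒ (x ∧ ∼ y) ≡ 𝟙
    ax8 : ∀ x y → (x ∧ ∼ y) ⇒ ∼ (x ⇒ y) ≡ 𝟙

module _ {a : Level} (T : SubresiduatedNelsonAlgebra a) where
  open SubresiduatedNelsonAlgebra T

  record IsImplicativeFilter {ℓ : Level} (F : Carrier → Set ℓ) : Set (a ⊔ ℓ) where
    field
      contains-𝟙 : F 𝟙
      mp : ∀ {x y} → F x → F (x ⇒ y) → F y

  record IsOpenImplicativeFilter {ℓ : Level} (F : Carrier → Set ℓ) : Set (a ⊔ ℓ) where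
    field
      isImplicativeFilter : IsImplicativeFilter F
      open-cond : ∀ {x} → F x → F (𝟙 ⇒ x)

  record IsHImplicativeFilter {ℓ : Level} (F : Carrier → Set ℓ) : Set (a ⊔ ℓ) where
    field
      isImplicativeFilter : IsImplicativeFilter F
      F1 : ∀ x y f → F f → F ((x ⇒ y) ⇒ ((x ∧ f) ⇒ (y ∧ f)))
      F2 : ∀ x y f → F f → F (((x ∧ f) ⇒ (y ∧ f)) ⇒ (x ⇒ y))
      F3 : ∀ x y f → F f → F (∼ (x ⇒ y) ⇒ ∼ ((x ∧ f) ⇒ (y ∧ f)))
      F4 : ∀ x y f → F f → F (∼ ((x ∧ f) ⇒ (y ∧ f)) ⇒ ∼ (x ⇒ y))

{-# OPTIONS --safe #-}
module Submission where

-- For an implicative filter F, x ≲ y := (x ⇒ y) ∈ F is a preorder extending the lattice order, in which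
-- meets are greatest lower bounds and joins least upper bounds (axioms 1–4 and 6). Conditions F1 and F4
-- then hold in every implicative filter: F1 because x ⇒ y ≤ (x ∧ f) ⇒ (y ∧ f) already in T, F4 because
-- ∼((x ∧ f) ⇒ (y ∧ f)) ≲ (x ∧ f) ∧ ∼(y ∧ f) splits into a part below x ∧ ∼ y and a part below f ∧ ∼ f,
-- which is ≲ everything by axiom 8. Openness says precisely that x ≲ f for every f ∈ F (as 𝟙 ⇒ f ≤ x ⇒ f),
-- so x ≲ x ∧ f, and F2, F3 follow by composing with axioms 3, 7 and 8. Conversely F2 for 𝟙, f, f reads
-- (f ⇒ f) ⇒ (𝟙 ⇒ f) ∈ F, so 𝟙 ⇒ f ∈ F.

open import Defs
open import Level using (Level)
open import Function.Bundles using (_⇔_; mk⇔)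
open import Relation.Binary.PropositionalEquality
  using (_≡_; refl; sym; trans; cong; cong₂; subst; isEquivalence; module ≡-Reasoning)
open import Relation.Binary.Structures using (IsPreorder)
open import Relation.Binary.Bundles using (Preorder)
open import Algebra.Lattice.Bundles using (Lattice)
open import Algebra.Lattice.Structures using (IsDistributiveLattice)
import Algebra.Lattice.Properties.Lattice as LatticeProperties
import Relation.Binary.Lattice.Bundles as OrderTheoretic
import Relation.Binary.Lattice.Properties.JoinSemilattice as JoinSemilatticeProperties
import Relation.Binary.Lattice.Properties.MeetSemilattice as MeetSemilatticeProperties
import Relation.Binary.Reasoning.Preorder as PreorderReasoning

module NelsonAlgebraProperties {a : Level} (T : SubresiduatedNelsonAlgebra a) where
  open SubresiduatedNelsonAlgebra T hiding (_≤_)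
  open IsDistributiveLattice isDistributiveLattice using (isLattice; ∧-comm; ∨-comm)

  lattice : Lattice a a
  lattice = record { isLattice = isLattice }

  -- _≤_ below is T's order x ∧ y ≡ x, taken in the symmetric form x ≡ x ∧ y of the library's natural lattice order.
  open LatticeProperties lattice public using (∧-idem)
  open LatticeProperties lattice using (∨-∧-orderTheoreticLattice)
  open OrderTheoretic.Lattice ∨-∧-orderTheoreticLattice public
    using (_≤_; x∧y≤x; x∧y≤y; x≤x∨y; ∧-greatest)
    renaming (refl to ≤-refl; trans to ≤-trans)
  open OrderTheoretic.Lattice ∨-∧-orderTheoreticLattice using (joinSemilattice; meetSemilattice)
  open JoinSemilatticeProperties joinSemilattice using (x≤y⇒x∨y≈y)
  open MeetSemilatticeProperties meetSemilattice public using (∧-monotonic)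

  x≤𝟙 : ∀ x → x ≤ 𝟙
  x≤𝟙 x = sym (𝟙-greatest x)

  𝟙∧x≡x : ∀ x → 𝟙 ∧ x ≡ x
  𝟙∧x≡x x = trans (∧-comm 𝟙 x) (𝟙-greatest x)

  ∼-antitone : ∀ {x y} → x ≤ y → ∼ y ≤ ∼ x
  ∼-antitone {x} {y} x≤y = subst (∼ y ≤_) ∼y∨∼x≡∼x (x≤x∨y (∼ y) (∼ x))
    where
    ∼y∨∼x≡∼x : ∼ y ∨ ∼ x ≡ ∼ x
    ∼y∨∼x≡∼x = sym (trans (cong ∼ x≤y) (trans (∼-deMorgan x y) (∨-comm (∼ x) (∼ y))))

  ∼𝟙≤x : ∀ x → ∼ 𝟙 ≤ x
  ∼𝟙≤x x = subst (∼ 𝟙 ≤_) (∼-invol x) (∼-antitone (x≤𝟙 (∼ x)))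

  x⇒x∧y≡x⇒y : ∀ x y → x ⇒ (x ∧ y) ≡ x ⇒ y
  x⇒x∧y≡x⇒y x y = trans (ax2 x y x) (trans (cong (_∧ (x ⇒ y)) (ax4 x)) (𝟙∧x≡x (x ⇒ y)))

  x⇒y≤z⇒x⇒y : ∀ x y z → x ⇒ y ≤ z ⇒ (x ⇒ y)
  x⇒y≤z⇒x⇒y x y z = sym (ax6 x y z)

  ≤→⇒≡𝟙 : ∀ {x y} → x ≤ y → x ⇒ y ≡ 𝟙
  ≤→⇒≡𝟙 {x} {y} x≤y = begin
    x ⇒ y        ≡⟨ sym (x⇒x∧y≡x⇒y x y) ⟩
    x ⇒ (x ∧ y)  ≡⟨ cong (x ⇒_) (sym x≤y) ⟩
    x ⇒ x        ≡⟨ ax4 x ⟩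
    𝟙            ∎
    where open ≡-Reasoning

  ⇒-antitoneˡ : ∀ {x y} z → x ≤ y → y ⇒ z ≤ x ⇒ z
  ⇒-antitoneˡ {x} {y} z x≤y = subst (_≤ x ⇒ z) meet≡ (x∧y≤x (x ⇒ z) (y ⇒ z))
    where
    meet≡ : (x ⇒ z) ∧ (y ⇒ z) ≡ y ⇒ z
    meet≡ = trans (sym (ax1 x y z)) (cong (_⇒ z) (x≤y⇒x∨y≈y x≤y))

  ⇒-monotoneʳ : ∀ {x y} z → x ≤ y → z ⇒ x ≤ z ⇒ y
  ⇒-monotoneʳ {x} {y} z x≤y = trans (cong (z ⇒_) x≤y) (ax2 x y z)

  ⇒-restrict : ∀ x y f → x ⇒ y ≤ (x ∧ f) ⇒ (y ∧ f)
  ⇒-restrict x y f = subst (x ⇒ y ≤_) restrict≡ (⇒-antitoneˡ y (x∧y≤x x f))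
    where
    open ≡-Reasoning
    restrict≡ : (x ∧ f) ⇒ y ≡ (x ∧ f) ⇒ (y ∧ f)
    restrict≡ = begin
      (x ∧ f) ⇒ y                        ≡⟨ 𝟙-greatest _ ⟨
      ((x ∧ f) ⇒ y) ∧ 𝟙                  ≡⟨ cong (((x ∧ f) ⇒ y) ∧_) (≤→⇒≡𝟙 (x∧y≤y x f)) ⟨
      ((x ∧ f) ⇒ y) ∧ ((x ∧ f) ⇒ f)      ≡⟨ ax2 y f (x ∧ f) ⟨
      (x ∧ f) ⇒ (y ∧ f)                  ∎

module ImplicativeFilterProperties
  {a ℓ : Level} {T : SubresiduatedNelsonAlgebra a}
  {F : SubresiduatedNelsonAlgebra.Carrier T → Set ℓ} (isFilter : IsImplicativeFilter T F) where
  open SubresiduatedNelsonAlgebra T hiding (_≤_)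
  open IsDistributiveLattice isDistributiveLattice using (∧-distribˡ-∨)
  open NelsonAlgebraProperties T
  open IsImplicativeFilter isFilter

  infix 4 _≲_
  _≲_ : Carrier → Carrier → Set ℓ
  x ≲ y = F (x ⇒ y)

  ≡𝟙→∈ : ∀ {x} → x ≡ 𝟙 → F x
  ≡𝟙→∈ x≡𝟙 = subst F (sym x≡𝟙) contains-𝟙

  ≤→≲ : ∀ {x y} → x ≤ y → x ≲ y
  ≤→≲ x≤y = ≡𝟙→∈ (≤→⇒≡𝟙 x≤y)

  ∈-upward : ∀ {x y} → F x → x ≤ y → F y
  ∈-upward x∈F x≤y = mp x∈F (≤→≲ x≤y)

  -- Without openness only implications satisfy y ⇒ z ≤ x ⇒ (y ⇒ z) (axiom 6), whence the restricted meet-closure.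
  ∈-∧-⇒ : ∀ {x y z} → F x → F (y ⇒ z) → F (x ∧ (y ⇒ z))
  ∈-∧-⇒ {x} {y} {z} x∈F y⇒z∈F =
    mp x∈F (subst F (sym (x⇒x∧y≡x⇒y x (y ⇒ z))) (∈-upward y⇒z∈F (x⇒y≤z⇒x⇒y y z x)))

  ≲-trans : ∀ {x y z} → x ≲ y → y ≲ z → x ≲ z
  ≲-trans {x} {y} {z} x≲y y≲z = mp (∈-∧-⇒ x≲y y≲z) (≡𝟙→∈ (ax3 x y z))

  ≲-refl : ∀ {x} → x ≲ x
  ≲-refl {x} = ≡𝟙→∈ (ax4 x)

  ≲-isPreorder : IsPreorder _≡_ _≲_
  ≲-isPreorder = record { isEquivalence = isEquivalence ; reflexive = λ { refl → ≲-refl } ; trans = ≲-trans }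

  ≲-preorder : Preorder a a ℓ
  ≲-preorder = record { isPreorder = ≲-isPreorder }

  ∧-greatest-≲ : ∀ {x y z} → x ≲ y → x ≲ z → x ≲ y ∧ z
  ∧-greatest-≲ {x} {y} {z} x≲y x≲z = subst F (sym (ax2 y z x)) (∈-∧-⇒ x≲y x≲z)

  ∨-least-≲ : ∀ {x y z} → x ≲ z → y ≲ z → x ∨ y ≲ z
  ∨-least-≲ {x} {y} {z} x≲z y≲z = subst F (sym (ax1 x y z)) (∈-∧-⇒ x≲z y≲z)

  x∧∼x≲y : ∀ x y → x ∧ ∼ x ≲ y
  x∧∼x≲y x y = begin
    x ∧ ∼ x    ≲⟨ ≡𝟙→∈ (ax8 x x) ⟩
    ∼ (x ⇒ x)  ≡⟨ cong ∼ (ax4 x) ⟩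
    ∼ 𝟙        ≲⟨ ≤→≲ (∼𝟙≤x y) ⟩
    y          ∎
    where open PreorderReasoning ≲-preorder

  ∼⇒-unrestrict-≲ : ∀ x y f → ∼ ((x ∧ f) ⇒ (y ∧ f)) ≲ ∼ (x ⇒ y)
  ∼⇒-unrestrict-≲ x y f = begin
    ∼ ((x ∧ f) ⇒ (y ∧ f))                  ≲⟨ ≡𝟙→∈ (ax7 (x ∧ f) (y ∧ f)) ⟩
    (x ∧ f) ∧ ∼ (y ∧ f)                    ≡⟨ cong ((x ∧ f) ∧_) (∼-deMorgan y f) ⟩
    (x ∧ f) ∧ (∼ y ∨ ∼ f)                  ≡⟨ ∧-distribˡ-∨ (x ∧ f) (∼ y) (∼ f) ⟩
    ((x ∧ f) ∧ ∼ y) ∨ ((x ∧ f) ∧ ∼ f)      ≲⟨ ∨-least-≲ drop-f contradictory ⟩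
    x ∧ ∼ y                                ≲⟨ ≡𝟙→∈ (ax8 x y) ⟩
    ∼ (x ⇒ y)                              ∎
    where
    open PreorderReasoning ≲-preorder
    drop-f : (x ∧ f) ∧ ∼ y ≲ x ∧ ∼ y
    drop-f = ≤→≲ (∧-monotonic (x∧y≤x x f) ≤-refl)
    contradictory : (x ∧ f) ∧ ∼ f ≲ x ∧ ∼ y
    contradictory = ≲-trans (≤→≲ (∧-monotonic (x∧y≤y x f) ≤-refl)) (x∧∼x≲y f (x ∧ ∼ y))

  module Open (open-cond : ∀ {x} → F x → F (𝟙 ⇒ x)) where

    ∈→≲ : ∀ {y} x → F y → x ≲ y
    ∈→≲ {y} x y∈F = ∈-upward (open-cond y∈F) (⇒-antitoneˡ y (x≤𝟙 x))

    ≲-∧-∈ : ∀ {f} x → F f → x ≲ x ∧ f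
    ≲-∧-∈ x f∈F = ∧-greatest-≲ ≲-refl (∈→≲ x f∈F)

    ⇒-unrestrict-≲ : ∀ x y {f} → F f → (x ∧ f) ⇒ (y ∧ f) ≲ x ⇒ y
    ⇒-unrestrict-≲ x y {f} f∈F = begin
      (x ∧ f) ⇒ (y ∧ f)                          ≲⟨ ∧-greatest-≲ (∈→≲ _ (≲-∧-∈ x f∈F)) ≲-refl ⟩
      (x ⇒ (x ∧ f)) ∧ ((x ∧ f) ⇒ (y ∧ f))        ≲⟨ ≡𝟙→∈ (ax3 x (x ∧ f) (y ∧ f)) ⟩
      x ⇒ (y ∧ f)                                ≲⟨ ≤→≲ (⇒-monotoneʳ x (x∧y≤x y f)) ⟩
      x ⇒ y                                      ∎
      where open PreorderReasoning ≲-preorder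

    ∼⇒-restrict-≲ : ∀ x y {f} → F f → ∼ (x ⇒ y) ≲ ∼ ((x ∧ f) ⇒ (y ∧ f))
    ∼⇒-restrict-≲ x y {f} f∈F = begin
      ∼ (x ⇒ y)                  ≲⟨ ≡𝟙→∈ (ax7 x y) ⟩
      x ∧ ∼ y                    ≲⟨ ≲-∧-∈ (x ∧ ∼ y) f∈F ⟩
      (x ∧ ∼ y) ∧ f              ≲⟨ ≤→≲ rearrange ⟩
      (x ∧ f) ∧ ∼ (y ∧ f)        ≲⟨ ≡𝟙→∈ (ax8 (x ∧ f) (y ∧ f)) ⟩
      ∼ ((x ∧ f) ⇒ (y ∧ f))      ∎
      where
      open PreorderReasoning ≲-preorder
      rearrange : (x ∧ ∼ y) ∧ f ≤ (x ∧ f) ∧ ∼ (y ∧ f)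
      rearrange = ∧-greatest (∧-monotonic (x∧y≤x x (∼ y)) ≤-refl)
                             (≤-trans (x∧y≤x (x ∧ ∼ y) f)
                                      (≤-trans (x∧y≤y x (∼ y)) (∼-antitone (x∧y≤x y f))))

isHImplicativeFilter→isOpenImplicativeFilter :
  ∀ {a ℓ} {T : SubresiduatedNelsonAlgebra a} {F : SubresiduatedNelsonAlgebra.Carrier T → Set ℓ} →
  IsHImplicativeFilter T F → IsOpenImplicativeFilter T F
isHImplicativeFilter→isOpenImplicativeFilter {T = T} isH = record
  { isImplicativeFilter = isImplicativeFilter
  ; open-cond = λ {x} x∈F → mp (≡𝟙→∈ (𝟙∧x⇒x∧x≡𝟙 x)) (F2 𝟙 x x x∈F)
  }
  where
  open SubresiduatedNelsonAlgebra T hiding (_≤_)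
  open NelsonAlgebraProperties T
  open IsHImplicativeFilter isH
  open IsImplicativeFilter isImplicativeFilter using (mp)
  open ImplicativeFilterProperties isImplicativeFilter using (≡𝟙→∈)
  𝟙∧x⇒x∧x≡𝟙 : ∀ x → (𝟙 ∧ x) ⇒ (x ∧ x) ≡ 𝟙
  𝟙∧x⇒x∧x≡𝟙 x = trans (cong₂ _⇒_ (𝟙∧x≡x x) (∧-idem x)) (ax4 x)

isOpenImplicativeFilter→isHImplicativeFilter :
  ∀ {a ℓ} {T : SubresiduatedNelsonAlgebra a} {F : SubresiduatedNelsonAlgebra.Carrier T → Set ℓ} →
  IsOpenImplicativeFilter T F → IsHImplicativeFilter T F
isOpenImplicativeFilter→isHImplicativeFilter {T = T} isOpen = record
  { isImplicativeFilter = isImplicativeFilter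
  ; F1 = λ x y f _ → ≤→≲ (⇒-restrict x y f)
  ; F2 = λ x y f → ⇒-unrestrict-≲ x y
  ; F3 = λ x y f → ∼⇒-restrict-≲ x y
  ; F4 = λ x y f _ → ∼⇒-unrestrict-≲ x y f
  }
  where
  open IsOpenImplicativeFilter isOpen
  open NelsonAlgebraProperties T using (⇒-restrict)
  open ImplicativeFilterProperties isImplicativeFilter
  open Open open-cond

proposition54 : {a ℓ : Level} (T : SubresiduatedNelsonAlgebra a)
    (F : SubresiduatedNelsonAlgebra.Carrier T → Set ℓ) →
    IsHImplicativeFilter T F ⇔ IsOpenImplicativeFilter T F
proposition54 T F =
  mk⇔ isHImplicativeFilter→isOpenImplicativeFilter isOpenImplicativeFilter→isHImplicativeFilter
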